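{- Let $\pi$ be a permutation of $[n]$ and let $\rho:[n]\to\mathbb{N}$ be a pile assignment function that sorts $\pi$ on stacks, with $\rho(1)=1$. Then $$\rho(n)\ \ge\ 1+\mathrm{ascs}(\pi)=\mathrm{descrun}(\pi).$$
   Context: A deck of cards labelled by $[n]$ is represented by a permutation $\pi$ of $[n]$ with $\pi(s)$ the position (from the top) of label $s$. The stack shuffle of $\pi$ with pile assignments $\rho$ (label $s$ goes to the $\rho(s)$-th pile collected) is the unique permutation $\sigma$ of $[n]$ with $\sigma(s)<\sigma(t)$ iff $(\rho(s),-\pi(s))<(\rho(t),-\pi(t))$ lexicographically; $\rho$ sorts $\pi$ on stacks if $\sigma$ is the identity. $\mathrm{ascs}(\pi)=\sum_{s=1}^{n-1}[\pi(s+1)>\pi(s)]$ is the number of ascents of $(\pi(1),\dots,\pi(n))$ and $\mathrm{descrun}(\pi)$ is its number of descending runs (maximal contiguous decreasing segments). -}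

module Defs where

open import Data.Nat using (ℕ; zero; suc; _+_; _<_; _<?_)
open import Data.Fin using (Fin; toℕ)
open import Data.List using (List; []; _∷_; [_]; length; map; foldr; allFin)
open import Data.Product using (_×_)
open import Data.Sum using (_⊎_)
open import Function.Bundles using (_↔_; Inverse)
open import Relation.Binary.PropositionalEquality using (_≡_)
open import Relation.Nullary using (yes; no)

-- A deck of n cards: a permutation π of [n] (labels are Fin n, label s+1 ↦ index s),
-- π(s) = position of label s.
Perm : ℕ → Set
Perm n = Fin n ↔ Fin n

-- position of label s (0-indexed as a natural number; only comparisons matter)
pos : ∀ {n} → Perm n → Fin n → ℕ
pos π s = toℕ (Inverse.to π s)

-- Lexicographic strict order on keys (ρ(s), -π(s)) vs (ρ(t), -π(t)):
-- ρ s < ρ t, or ρ s = ρ t and -π s < -π t (i.e. π t < π s).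
KeyLt : ∀ {n} → Perm n → (Fin n → ℕ) → Fin n → Fin n → Set
KeyLt π ρ s t = (ρ s < ρ t) ⊎ ((ρ s ≡ ρ t) × (pos π t < pos π s))

-- The stack shuffle σ is the unique permutation with σ s < σ t ⇔ KeyLt s t.
-- ρ sorts π on stacks iff σ is the identity, i.e. iff the identity permutation
-- satisfies this defining property (by uniqueness of σ).
SortsOnStacks : ∀ {n} → Perm n → (Fin n → ℕ) → Set
SortsOnStacks π ρ =
  ∀ s t → ((Data.Fin._<_ s t → KeyLt π ρ s t) × (KeyLt π ρ s t → Data.Fin._<_ s t))

seq : ∀ {n} → Perm n → List ℕ
seq {n} π = map (pos π) (allFin n)

ascentsFrom : ℕ → List ℕ → ℕ
ascentsFrom x [] = 0
ascentsFrom x (y ∷ xs) with x <? y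
... | yes _ = suc (ascentsFrom y xs)
... | no _ = ascentsFrom y xs

ascents : List ℕ → ℕ
ascents [] = 0
ascents (x ∷ xs) = ascentsFrom x xs

-- split a sequence into its maximal contiguous (strictly) decreasing runs
addToRuns : ℕ → List (List ℕ) → List (List ℕ)
addToRuns x [] = [ [ x ] ]
addToRuns x ([] ∷ rs) = [ x ] ∷ [] ∷ rs
addToRuns x ((y ∷ r) ∷ rs) with y <? x
... | yes _ = (x ∷ y ∷ r) ∷ rs
... | no _ = [ x ] ∷ (y ∷ r) ∷ rs

descRuns : List ℕ → List (List ℕ)
descRuns = foldr addToRuns []

ascs : ∀ {n} → Perm n → ℕ
ascs π = ascents (seq π)

descrun : ∀ {n} → Perm n → ℕ
descrun π = length (descRuns (seq π))

{-# OPTIONS --safe #-}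
module Submission where

open import Defs
open import Data.Nat using (ℕ; suc; _+_; _≥_)
open import Data.Fin using (Fin; zero; fromℕ)
open import Data.Product using (_×_)
open import Relation.Binary.PropositionalEquality using (_≡_)

open import Data.Nat using (_≤_; _<_; _<?_)
open import Data.Nat.Properties
  using (module ≤-Reasoning; ≤-refl; ≤-trans; ≤-reflexive; <⇒≤; <-asym; +-identityʳ; +-suc; +-monoˡ-≤; ≤∧≮⇒≡; ≮⇒≥)
open import Data.Fin as Fin using (inject₁)
open import Data.Fin.Properties using (toℕ-injective; ≤̄⇒inject₁<)
open import Data.List using ([]; _∷_; tabulate; length)
open import Data.List.Properties using (map-tabulate)
open import Data.List.Relation.Unary.Linked using (Linked; _∷_)
open import Data.List.Relation.Unary.Linked.Properties using (AllPairs⇒Linked)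
open import Data.List.Relation.Unary.AllPairs.Properties using (tabulate⁺)
open import Data.Product using (∃₂; _,_; proj₁)
open import Data.Sum using (inj₁; inj₂)
open import Data.Empty using (⊥-elim)
open import Function using (_∘_; id)
open import Function.Bundles using (Injection)
open import Function.Properties.Inverse using (↔⇒↣)
open import Relation.Nullary using (yes; no)
open import Relation.Binary.PropositionalEquality using (_≢_; refl; sym; cong; cong₂; subst)

-- Sorting forces ρ(s) ≤ ρ(s+1) for consecutive labels, and since each pile is
-- collected in decreasing order of position, ρ(s) < ρ(s+1) whenever
-- π(s) < π(s+1).  Summing over s gives ρ(n) ≥ ρ(1) + ascs π.  Positions are
-- distinct, so every non-ascent is a descent and the ascents are exactly the
-- breaks between consecutive descending runs.

head+ascents≤last : ∀ {m} (g r : Fin (suc m) → ℕ) →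
  (∀ i → r (inject₁ i) ≤ r (Fin.suc i)) →
  (∀ i → g (inject₁ i) < g (Fin.suc i) → r (inject₁ i) < r (Fin.suc i)) →
  r zero + ascents (tabulate g) ≤ r (fromℕ m)
head+ascents≤last {ℕ.zero} g r r-mono r-rises = ≤-reflexive (+-identityʳ (r zero))
head+ascents≤last {suc m} g r r-mono r-rises
  with g zero <? g (Fin.suc zero)
     | head+ascents≤last (g ∘ Fin.suc) (r ∘ Fin.suc) (r-mono ∘ Fin.suc) (r-rises ∘ Fin.suc)
... | yes g₀<g₁ | tail = begin
  r zero + suc (ascents (tabulate (g ∘ Fin.suc)))      ≡⟨ +-suc (r zero) _ ⟩
  suc (r zero) + ascents (tabulate (g ∘ Fin.suc))      ≤⟨ +-monoˡ-≤ _ (r-rises zero g₀<g₁) ⟩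
  r (Fin.suc zero) + ascents (tabulate (g ∘ Fin.suc))  ≤⟨ tail ⟩
  r (fromℕ (suc m))                                    ∎
  where open ≤-Reasoning
... | no _ | tail = ≤-trans (+-monoˡ-≤ _ (r-mono zero)) tail

addToRuns-head : ∀ x rs → ∃₂ λ r rs′ → addToRuns x rs ≡ (x ∷ r) ∷ rs′
addToRuns-head x [] = [] , [] , refl
addToRuns-head x ([] ∷ rs) = [] , [] ∷ rs , refl
addToRuns-head x ((y ∷ r) ∷ rs) with y <? x
... | yes _ = y ∷ r , rs , refl
... | no _ = [] , (y ∷ r) ∷ rs , refl

length-descRuns : ∀ x xs → Linked _≢_ (x ∷ xs) →
  length (descRuns (x ∷ xs)) ≡ suc (ascents (x ∷ xs))
length-descRuns x [] _ = refl
length-descRuns x (y ∷ zs) (x≢y ∷ linked)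
  with addToRuns-head y (descRuns zs) | length-descRuns y zs linked
... | r , rs , runs≡ | ih rewrite runs≡ with y <? x | x <? y
... | yes y<x | yes x<y = ⊥-elim (<-asym y<x x<y)
... | yes _   | no _    = ih
... | no _    | yes _   = cong suc ih
... | no y≮x  | no x≮y  = ⊥-elim (x≢y (≤∧≮⇒≡ (≮⇒≥ y≮x) x≮y))

module _ {n} (π : Perm n) where

  seq≡tabulate : seq π ≡ tabulate (pos π)
  seq≡tabulate = map-tabulate id (pos π)

  pos-injective : ∀ {s t} → pos π s ≡ pos π t → s ≡ t
  pos-injective = Injection.injective (↔⇒↣ π) ∘ toℕ-injective

  seq-linked : Linked _≢_ (seq π)
  seq-linked = subst (Linked _≢_) (sym seq≡tabulate)
    (AllPairs⇒Linked (tabulate⁺ (λ s≢t → s≢t ∘ pos-injective)))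

  module _ (ρ : Fin n → ℕ) where

    KeyLt⇒≤ : ∀ {s t} → KeyLt π ρ s t → ρ s ≤ ρ t
    KeyLt⇒≤ (inj₁ ρs<ρt) = <⇒≤ ρs<ρt
    KeyLt⇒≤ (inj₂ (ρs≡ρt , _)) = ≤-reflexive ρs≡ρt

    KeyLt∧pos<⇒< : ∀ {s t} → KeyLt π ρ s t → pos π s < pos π t → ρ s < ρ t
    KeyLt∧pos<⇒< (inj₁ ρs<ρt) _ = ρs<ρt
    KeyLt∧pos<⇒< (inj₂ (_ , pt<ps)) ps<pt = ⊥-elim (<-asym ps<pt pt<ps)

SortsOnStacks⇒KeyLt-adjacent : ∀ {m} (π : Perm (suc m)) ρ → SortsOnStacks π ρ →
  ∀ i → KeyLt π ρ (inject₁ i) (Fin.suc i)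
SortsOnStacks⇒KeyLt-adjacent π ρ sorts i = proj₁ (sorts _ _) (≤̄⇒inject₁< ≤-refl)

lemma5 : (m : ℕ) (π : Perm (suc m)) (ρ : Fin (suc m) → ℕ) →
    SortsOnStacks π ρ → ρ zero ≡ 1 →
    (ρ (fromℕ m) ≥ 1 + ascs π) × (1 + ascs π ≡ descrun π)
lemma5 m π ρ sorts ρ₀≡1 = piles , runs
  where
  adjacent : ∀ i → KeyLt π ρ (inject₁ i) (Fin.suc i)
  adjacent = SortsOnStacks⇒KeyLt-adjacent π ρ sorts

  piles : ρ (fromℕ m) ≥ 1 + ascs π
  piles = begin
    1 + ascs π                           ≡⟨ cong₂ _+_ (sym ρ₀≡1) (cong ascents (seq≡tabulate π)) ⟩
    ρ zero + ascents (tabulate (pos π))  ≤⟨ head+ascents≤last (pos π) ρ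
                                              (KeyLt⇒≤ π ρ ∘ adjacent) (KeyLt∧pos<⇒< π ρ ∘ adjacent) ⟩
    ρ (fromℕ m)                          ∎
    where open ≤-Reasoning

  runs : 1 + ascs π ≡ descrun π
  runs = sym (length-descRuns _ _ (seq-linked π))
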